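{- Let $\mathbb{Z}^d=\langle e_0,\ldots,e_{d-1}\rangle\curvearrowright X$ be a free Borel action on a standard Borel space whose grid graph $G$ admits a Borel $2^d$-polychromatic coloring. Then for each $i<d$ there is a Borel proper $2$-coloring $c_i:X\to\{0,1\}$ of the $i$-th $\mathbb{Z}$-subaction $\langle e_i\rangle\curvearrowright X$, i.e. $c_i(e_i\cdot x)\neq c_i(x)$ for all $x\in X$.
   Context: The grid graph $G$ of a free Borel action $\mathbb{Z}^d\curvearrowright X$ (with standard generators $e_0,\dots,e_{d-1}$) has vertex set $X$ and edges between $x$ and $e_i\cdot x$ for $x\in X$, $i<d$. A Borel $k$-polychromatic coloring of $G$ is a Borel map $c:X\to[k]$ such that for every $x\in X$ the unit cube $\{0,1\}^d\cdot x=\{g\cdot x:g\in\{0,1\}^d\}$ contains all $k$ colors. -}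

module Defs where

open import Data.Nat using (ℕ; _^_)
open import Data.Bool using (Bool; true; false; if_then_else_)
open import Data.Integer using (ℤ; +_) renaming (_+_ to _+ℤ_)
open import Data.Fin using (Fin; _≟_)
open import Data.Vec using (Vec; tabulate; zipWith; replicate; map)
open import Data.Product using (Σ; _×_; _,_)
open import Relation.Nullary using (¬_)
open import Relation.Nullary.Decidable using (⌊_⌋)
open import Relation.Binary.PropositionalEquality using (_≡_)

Cantor : Set
Cantor = ℕ → Bool

data IsBorel : (Cantor → Set) → Set₁ where
  basic : (n : ℕ) → IsBorel (λ s → s n ≡ true)
  compl : {P : Cantor → Set} → IsBorel P → IsBorel (λ s → ¬ P s)
  inter : {P Q : Cantor → Set} → IsBorel P → IsBorel Q → IsBorel (λ s → P s × Q s)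
  union : (P : ℕ → Cantor → Set) → ((n : ℕ) → IsBorel (P n)) →
          IsBorel (λ s → Σ ℕ (λ n → P n s))
  ext   : {P Q : Cantor → Set} → IsBorel P →
          ((s : Cantor) → P s → Q s) → ((s : Cantor) → Q s → P s) → IsBorel Q

-- A standard Borel space, presented (up to Borel isomorphism) as a Borel
-- subset of Cantor space: a carrier with an injective embedding into
-- Cantor space whose image is Borel; its Borel sets are the traces of
-- Borel subsets of Cantor space.
record StandardBorel : Set₁ where
  field
    Carrier : Set
    embed   : Carrier → Cantor
    embed-injective : (x y : Carrier) → ((n : ℕ) → embed x n ≡ embed y n) → x ≡ y
    image-Borel : IsBorel (λ s → Σ Carrier (λ x → (n : ℕ) → embed x n ≡ s n))

open StandardBorel public

BorelSet : (X : StandardBorel) → (Carrier X → Set) → Set₁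
BorelSet X P = Σ (Cantor → Set) λ C → IsBorel C ×
  ((x : Carrier X) → (C (embed X x) → P x) × (P x → C (embed X x)))

BorelMap : (X : StandardBorel) → (Carrier X → Carrier X) → Set₁
BorelMap X f = (P : Carrier X → Set) → BorelSet X P → BorelSet X (λ x → P (f x))

BorelColoring : (X : StandardBorel) {k : ℕ} → (Carrier X → Fin k) → Set₁
BorelColoring X {k} c = (j : Fin k) → BorelSet X (λ x → c x ≡ j)

zeroᵈ : {d : ℕ} → Vec ℤ d
zeroᵈ {d} = replicate d (+ 0)

_+ᵈ_ : {d : ℕ} → Vec ℤ d → Vec ℤ d → Vec ℤ d
_+ᵈ_ = zipWith _+ℤ_

gen : {d : ℕ} → Fin d → Vec ℤ d
gen i = tabulate (λ j → if ⌊ i ≟ j ⌋ then + 1 else + 0)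

record FreeBorelAction (d : ℕ) (X : StandardBorel) : Set₁ where
  field
    act      : Vec ℤ d → Carrier X → Carrier X
    act-zero : (x : Carrier X) → act zeroᵈ x ≡ x
    act-add  : (g h : Vec ℤ d) (x : Carrier X) → act (g +ᵈ h) x ≡ act g (act h x)
    act-Borel : (g : Vec ℤ d) → BorelMap X (act g)
    free     : (g : Vec ℤ d) (x : Carrier X) → act g x ≡ x → g ≡ zeroᵈ

open FreeBorelAction public

cubeVec : {d : ℕ} → Vec Bool d → Vec ℤ d
cubeVec = map (λ b → if b then + 1 else + 0)

Polychromatic : {d : ℕ} {X : StandardBorel} → FreeBorelAction d X →
                (k : ℕ) → (Carrier X → Fin k) → Set
Polychromatic {d} α k c = (x : _) (j : Fin k) →
  Σ (Vec Bool d) λ b → c (act α (cubeVec b) x) ≡ j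

-- Each unit cube {0,1}^d · x has exactly 2^d vertices, so a 2^d-polychromatic colouring
-- is injective on every cube and each colour, say j, marks exactly one vertex
-- corner(x) · x of the cube at x.  Moving from x to e_i · x shifts the cube by e_i, and the
-- vertex of colour j keeps its position in X, so the i-th coordinate of corner(x) flips.
-- Hence x ↦ corner(x)_i properly 2-colours the e_i-orbits, and it is Borel because
-- corner(x)_i = 1 iff some vertex b with b_i = 1 of the cube at x has colour j, a finite
-- union of preimages of a colour class under Borel translations.
module Submission where

open import Defs
open import Data.Nat using (ℕ; zero; suc; _^_)
open import Data.Nat.Properties using (n<1+n)
open import Data.Bool using (Bool; true; false; if_then_else_)
open import Data.Bool.Properties using (¬-not; not-¬)
open import Data.Integer using (ℤ; +_) renaming (_+_ to _+ℤ_)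
open import Data.Integer.Properties using (+-identityʳ)
open import Data.Fin using (Fin; punchOut; funToFin; finToFun)
open import Data.Fin.Properties
  using (_≟_; any?; pigeonhole; punchOut-injective; <⇒≢; 2↔Bool; finToFun-funToFin)
open import Data.Vec using (Vec; []; _∷_; lookup; replicate; _[_]≔_)
open import Data.Vec.Properties
  using (tabulate∘lookup; tabulate-cong; lookup∘tabulate; lookup-map; lookup-zipWith;
         lookup∘update; lookup∘update′; []≔-idempotent; []≔-lookup)
open import Data.Product using (Σ; _×_; _,_; proj₁; proj₂)
open import Data.Sum using (_⊎_; inj₁; inj₂)
open import Function using (_∘_; Inverse)
open import Function.Definitions using (Injective; StrictlySurjective)
open import Relation.Nullary using (¬_; yes; no; contradiction)
open import Relation.Nullary.Decidable using (⌊_⌋)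
open import Relation.Binary.PropositionalEquality
  using (_≡_; _≢_; refl; sym; trans; cong; module ≡-Reasoning)

open Inverse 2↔Bool using (strictlyInverseˡ; strictlyInverseʳ)
  renaming (to to toBool; from to fromBool)

-- A missed value k could be punched out, giving an injection Fin (suc m) → Fin m.
injective⇒strictlySurjective : {n : ℕ} (f : Fin n → Fin n) →
  Injective _≡_ _≡_ f → StrictlySurjective _≡_ f
injective⇒strictlySurjective {suc m} f f-inj k with any? (λ j → f j ≟ k)
... | yes hit = hit
... | no miss =
  let i , j , i<j , pᵢ≡pⱼ = pigeonhole (n<1+n m) (λ j → punchOut (k≢f j))
  in contradiction (f-inj (punchOut-injective (k≢f i) (k≢f j) pᵢ≡pⱼ)) (<⇒≢ i<j)
  where
  k≢f : ∀ j → k ≢ f j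
  k≢f j k≡fj = miss (j , sym k≡fj)

-- If s is a section of f, then e ∘ s is an injective endomap of Fin n, hence onto, so s is
-- onto as well and therefore a two-sided inverse of f.
strictlySurjective⇒injective : {A : Set} {n : ℕ} (e : A → Fin n) → Injective _≡_ _≡_ e →
  (f : A → Fin n) → StrictlySurjective _≡_ f → Injective _≡_ _≡_ f
strictlySurjective⇒injective {A} e e-inj f f-surj {a} {b} fa≡fb = begin
  a         ≡⟨ s∘f a ⟨
  s (f a)   ≡⟨ cong s fa≡fb ⟩
  s (f b)   ≡⟨ s∘f b ⟩
  b         ∎
  where
  open ≡-Reasoning
  s : Fin _ → A
  s = proj₁ ∘ f-surj
  f∘s : ∀ k → f (s k) ≡ k
  f∘s = proj₂ ∘ f-surj
  e∘s-injective : Injective _≡_ _≡_ (e ∘ s)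
  e∘s-injective {k} {l} eq = trans (sym (f∘s k)) (trans (cong f (e-inj eq)) (f∘s l))
  s∘f : ∀ a → s (f a) ≡ a
  s∘f a with k , esk≡ea ← injective⇒strictlySurjective (e ∘ s) e∘s-injective (e a) = begin
    s (f a)       ≡⟨ cong (s ∘ f) (e-inj esk≡ea) ⟨
    s (f (s k))   ≡⟨ cong s (f∘s k) ⟩
    s k           ≡⟨ e-inj esk≡ea ⟩
    a             ∎

fromBool-injective : Injective _≡_ _≡_ fromBool
fromBool-injective {β} {γ} eq =
  trans (sym (strictlyInverseˡ β)) (trans (cong toBool eq) (strictlyInverseˡ γ))

lookup-extensional : {A : Set} {n : ℕ} {u v : Vec A n} → (∀ k → lookup u k ≡ lookup v k) → u ≡ v
lookup-extensional {u = u} {v} u≗v =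
  trans (sym (tabulate∘lookup u)) (trans (tabulate-cong u≗v) (tabulate∘lookup v))

[]≔-id : {A : Set} {n : ℕ} (xs : Vec A n) (i : Fin n) {y : A} → lookup xs i ≡ y → xs [ i ]≔ y ≡ xs
[]≔-id xs i refl = []≔-lookup xs i

[]≔-[]≔-id : {A : Set} {n : ℕ} (xs : Vec A n) (i : Fin n) {y z : A} → lookup xs i ≡ y →
  (xs [ i ]≔ z) [ i ]≔ y ≡ xs
[]≔-[]≔-id xs i xsᵢ≡y = trans ([]≔-idempotent xs i) ([]≔-id xs i xsᵢ≡y)

encode : {n : ℕ} → Vec Bool n → Fin (2 ^ n)
encode b = funToFin (fromBool ∘ lookup b)

encode-injective : {n : ℕ} → Injective _≡_ _≡_ (encode {n})
encode-injective {x = u} {y = v} eq = lookup-extensional λ k → begin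
  lookup u k
    ≡⟨ strictlyInverseˡ (lookup u k) ⟨
  toBool (fromBool (lookup u k))
    ≡⟨ cong toBool (finToFun-funToFin (fromBool ∘ lookup u) k) ⟨
  toBool (finToFun (encode u) k)
    ≡⟨ cong (λ m → toBool (finToFun m k)) eq ⟩
  toBool (finToFun (encode v) k)
    ≡⟨ cong toBool (finToFun-funToFin (fromBool ∘ lookup v) k) ⟩
  toBool (fromBool (lookup v k))
    ≡⟨ strictlyInverseˡ (lookup v k) ⟩
  lookup v k
    ∎
  where open ≡-Reasoning

cubeVec-set : {n : ℕ} (b : Vec Bool n) (i : Fin n) → lookup b i ≡ false →
  cubeVec (b [ i ]≔ true) ≡ cubeVec b +ᵈ gen i
cubeVec-set b i bᵢ≡false = lookup-extensional λ k → begin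
  lookup (cubeVec (b [ i ]≔ true)) k
    ≡⟨ lookup-map k ⟦_⟧ (b [ i ]≔ true) ⟩
  ⟦ lookup (b [ i ]≔ true) k ⟧
    ≡⟨ entry k ⟩
  ⟦ lookup b k ⟧ +ℤ ⟦ ⌊ i ≟ k ⌋ ⟧
    ≡⟨ cong (⟦ lookup b k ⟧ +ℤ_) (lookup∘tabulate _ k) ⟨
  ⟦ lookup b k ⟧ +ℤ lookup (gen i) k
    ≡⟨ cong (_+ℤ lookup (gen i) k) (lookup-map k ⟦_⟧ b) ⟨
  lookup (cubeVec b) k +ℤ lookup (gen i) k
    ≡⟨ lookup-zipWith _+ℤ_ k (cubeVec b) (gen i) ⟨
  lookup (cubeVec b +ᵈ gen i) k
    ∎
  where
  open ≡-Reasoning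
  ⟦_⟧ : Bool → ℤ
  ⟦ β ⟧ = if β then + 1 else + 0
  entry : ∀ k → ⟦ lookup (b [ i ]≔ true) k ⟧ ≡ ⟦ lookup b k ⟧ +ℤ ⟦ ⌊ i ≟ k ⌋ ⟧
  entry k with i ≟ k
  ... | yes refl = trans (cong ⟦_⟧ (lookup∘update i b true))
                         (sym (cong (λ β → ⟦ β ⟧ +ℤ + 1) bᵢ≡false))
  ... | no i≢k   = trans (cong ⟦_⟧ (lookup∘update′ (i≢k ∘ sym) b true))
                         (sym (+-identityʳ _))

act-cubeVec-set : {d : ℕ} {X : StandardBorel} (α : FreeBorelAction d X)
  (b : Vec Bool d) (i : Fin d) (x : Carrier X) → lookup b i ≡ false →
  act α (cubeVec (b [ i ]≔ true)) x ≡ act α (cubeVec b) (act α (gen i) x)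
act-cubeVec-set α b i x bᵢ≡false =
  trans (cong (λ g → act α g x) (cubeVec-set b i bᵢ≡false)) (act-add α (cubeVec b) (gen i) x)

module _ (X : StandardBorel) where

  borelSet-resp : {P Q : Carrier X → Set} → BorelSet X P →
    (∀ x → P x → Q x) → (∀ x → Q x → P x) → BorelSet X Q
  borelSet-resp (C , C-borel , C⇔P) P⇒Q Q⇒P =
    C , C-borel , λ x → P⇒Q x ∘ proj₁ (C⇔P x) , proj₂ (C⇔P x) ∘ Q⇒P x

  borelSet-∁ : {P : Carrier X → Set} → BorelSet X P → BorelSet X (λ x → ¬ P x)
  borelSet-∁ (C , C-borel , C⇔P) =
    (λ s → ¬ C s) , compl C-borel ,
    λ x → (λ ¬c → ¬c ∘ proj₂ (C⇔P x)) , (λ ¬p → ¬p ∘ proj₁ (C⇔P x))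

  borelSet-∪ : {P Q : Carrier X → Set} → BorelSet X P → BorelSet X Q →
    BorelSet X (λ x → P x ⊎ Q x)
  borelSet-∪ {P} {Q} (C , C-borel , C⇔P) (D , D-borel , D⇔Q) =
    (λ s → Σ ℕ λ n → R n s) , union R R-borel , λ x → R⇒P⊎Q x , P⊎Q⇒R x
    where
    R : ℕ → Cantor → Set
    R zero    = C
    R (suc _) = D
    R-borel : ∀ n → IsBorel (R n)
    R-borel zero    = C-borel
    R-borel (suc _) = D-borel
    R⇒P⊎Q : ∀ x → Σ ℕ (λ n → R n (embed X x)) → P x ⊎ Q x
    R⇒P⊎Q x (zero  , r) = inj₁ (proj₁ (C⇔P x) r)
    R⇒P⊎Q x (suc _ , r) = inj₂ (proj₁ (D⇔Q x) r)
    P⊎Q⇒R : ∀ x → P x ⊎ Q x → Σ ℕ (λ n → R n (embed X x))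
    P⊎Q⇒R x (inj₁ p) = zero , proj₂ (C⇔P x) p
    P⊎Q⇒R x (inj₂ q) = suc zero , proj₂ (D⇔Q x) q

  borelSet-∃Vec : (n : ℕ) (P : Vec Bool n → Carrier X → Set) → (∀ b → BorelSet X (P b)) →
    BorelSet X (λ x → Σ (Vec Bool n) λ b → P b x)
  borelSet-∃Vec zero P P-borel =
    borelSet-resp (P-borel []) (λ _ p → [] , p) (λ { _ ([] , p) → p })
  borelSet-∃Vec (suc n) P P-borel =
    borelSet-resp (borelSet-∪ (borelSet-∃Vec n (P ∘ (false ∷_)) (P-borel ∘ (false ∷_)))
                              (borelSet-∃Vec n (P ∘ (true ∷_)) (P-borel ∘ (true ∷_))))
      (λ { _ (inj₁ (b , p)) → false ∷ b , p ; _ (inj₂ (b , p)) → true ∷ b , p })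
      (λ { _ (false ∷ b , p) → inj₁ (b , p) ; _ (true ∷ b , p) → inj₂ (b , p) })

  borelColoring-fromBool : (f : Carrier X → Bool) → BorelSet X (λ x → f x ≡ true) →
    BorelColoring X (fromBool ∘ f)
  borelColoring-fromBool f f-borel j = borelSet-resp (fibre-borel (toBool j))
    (λ x fx≡ → trans (cong fromBool fx≡) (strictlyInverseʳ j))
    (λ x fx≡ → fromBool-injective (trans fx≡ (sym (strictlyInverseʳ j))))
    where
    fibre-borel : ∀ β → BorelSet X (λ x → f x ≡ β)
    fibre-borel true  = f-borel
    fibre-borel false = borelSet-resp (borelSet-∁ f-borel) (λ _ → ¬-not) (λ _ → not-¬)

module Corner {d : ℕ} {X : StandardBorel} (α : FreeBorelAction d X)
  (c : Carrier X → Fin (2 ^ d)) (c-borel : BorelColoring X c)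
  (poly : Polychromatic α (2 ^ d) c) (j : Fin (2 ^ d)) where

  colourAt : Carrier X → Vec Bool d → Fin (2 ^ d)
  colourAt x b = c (act α (cubeVec b) x)

  colourAt-injective : ∀ x → Injective _≡_ _≡_ (colourAt x)
  colourAt-injective x = strictlySurjective⇒injective encode encode-injective (colourAt x) (poly x)

  corner : Carrier X → Vec Bool d
  corner x = proj₁ (poly x j)

  colourAt-corner : ∀ x → colourAt x (corner x) ≡ j
  colourAt-corner x = proj₂ (poly x j)

  corner-unique : ∀ x b → colourAt x b ≡ j → b ≡ corner x
  corner-unique x b cb≡j = colourAt-injective x (trans cb≡j (sym (colourAt-corner x)))

  module _ (i : Fin d) where

    colourAt-set : ∀ x b → lookup b i ≡ false →
      colourAt x (b [ i ]≔ true) ≡ colourAt (act α (gen i) x) b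
    colourAt-set x b bᵢ≡false = cong c (act-cubeVec-set α b i x bᵢ≡false)

    corner-set : ∀ x b → lookup b i ≡ false → corner (act α (gen i) x) ≡ b →
      corner x ≡ b [ i ]≔ true
    corner-set x b bᵢ≡false refl =
      sym (corner-unique x _ (trans (colourAt-set x b bᵢ≡false) (colourAt-corner _)))

    corner-unset : ∀ x b → lookup b i ≡ false → corner x ≡ b [ i ]≔ true →
      corner (act α (gen i) x) ≡ b
    corner-unset x b bᵢ≡false corner≡ =
      sym (corner-unique _ b (trans (sym (colourAt-set x b bᵢ≡false))
        (trans (cong (colourAt x) (sym corner≡)) (colourAt-corner x))))

    corner-bit-flips : ∀ x → lookup (corner (act α (gen i) x)) i ≢ lookup (corner x) i
    corner-bit-flips x with lookup (corner (act α (gen i) x)) i in bit-y | lookup (corner x) i in bit-x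
    ... | false | false = λ _ → contradiction (trans (sym x-bit) bit-x) λ ()
      where
      x-bit : lookup (corner x) i ≡ true
      x-bit = trans (cong (λ v → lookup v i) (corner-set x _ bit-y refl))
        (lookup∘update i (corner (act α (gen i) x)) true)
    ... | true  | true  = λ _ → contradiction (trans (sym bit-y) y-bit) λ ()
      where
      unset-bit : lookup (corner x [ i ]≔ false) i ≡ false
      unset-bit = lookup∘update i (corner x) false
      y-bit : lookup (corner (act α (gen i) x)) i ≡ false
      y-bit = trans (cong (λ v → lookup v i)
        (corner-unset x _ unset-bit (sym ([]≔-[]≔-id (corner x) i bit-x)))) unset-bit
    ... | false | true  = λ ()
    ... | true  | false = λ ()

    corner-bit-borel : BorelSet X (λ x → lookup (corner x) i ≡ true)
    corner-bit-borel = borelSet-resp X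
      (borelSet-∃Vec X d (λ b x → colourAt x (b [ i ]≔ true) ≡ j)
        (λ b → act-Borel α (cubeVec (b [ i ]≔ true)) (λ x → c x ≡ j) (c-borel j)))
      (λ { x (b , colour≡j) → trans (cong (λ v → lookup v i) (sym (corner-unique x _ colour≡j)))
                                     (lookup∘update i b true) })
      (λ x bit → corner x ,
        trans (cong (colourAt x) ([]≔-id (corner x) i bit)) (colourAt-corner x))

corollary4p3 : (d : ℕ) (X : StandardBorel) (α : FreeBorelAction d X) →
    Σ (Carrier X → Fin (2 ^ d)) (λ c → BorelColoring X c × Polychromatic α (2 ^ d) c) →
    (i : Fin d) →
    Σ (Carrier X → Fin 2) (λ ci → BorelColoring X ci ×
      ((x : Carrier X) → ¬ (ci (act α (gen i) x) ≡ ci x)))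
corollary4p3 d X α (c , c-borel , poly) i =
  fromBool ∘ cornerBit ,
  borelColoring-fromBool X cornerBit (corner-bit-borel i) ,
  λ x → corner-bit-flips i x ∘ fromBool-injective
  where
  -- any colour will do; this one is available without knowing 2 ^ d > 0
  open Corner α c c-borel poly (encode (replicate d false))
  cornerBit : Carrier X → Bool
  cornerBit x = lookup (corner x) i
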